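{- Let $\vec\kappa=\langle\kappa_0\le\dots\le\kappa_n\rangle$ be a weakly increasing tuple of cardinals, $-1\le k\le n$, and let $\langle Y_i:i\le n\rangle$ be a $k$-Fubini partition of $X(\vec\kappa)^-$. Then for any $A\subseteq\{0,\dots,n\}$ with $|A|\ge k+1$ and any $i\notin A$, $$\mathcal{D}_A\cap Y_i=\mathcal{D}_{A\cup\{i\}}\cap Y_i.$$
   Context: For a cardinal $\kappa$, $\alpha(\kappa)=\kappa\sqcup\{\infty\}$ is the one-point compactification of the discrete space $\kappa$. $X(\vec\kappa)=\prod_{i\le n}\alpha(\kappa_i)$ (product topology), $X(\vec\kappa)^-=X(\vec\kappa)\setminus\{(\infty,\dots,\infty)\}$. For $A\subseteq\{0,\dots,n\}$: $\mathcal{D}_A=\{\vec x\in X(\vec\kappa):x_i\ne\infty\ \forall i\in A\}$ (subspace topology); $F_A=\{\vec x\in X(\vec\kappa):x_i\ne\infty\iff i\in A\}$. For $\vec x\in F_A$ and finite sets $\mathcal{E}_j\subseteq\kappa_j$ ($j\notin A$), $\mathcal{N}_A(\vec x,\vec{\mathcal{E}})=\{\vec y\in X(\vec\kappa):y_i=x_i\ \forall i\in A,\ \text{and } y_j=\infty\text{ or }y_j\notin\mathcal{E}_j\ \forall j\notin A\}$. A $k$-Fubini partition of $X(\vec\kappa)^-$ is a partition $\langle Y_i:i\le n\rangle$ of $X(\vec\kappa)^-$ into $n+1$ (possibly empty) sets such that for every $A\subseteq\{0,\dots,n\}$ with $|A|\ge k+1$: (1) for every $i\notin A$, $Y_i\cap\mathcal{D}_A$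 is clopen in $\mathcal{D}_A$; (2) for every $\vec x\in F_A$ there exist finite $\mathcal{E}_j\subseteq\kappa_j$ ($j\notin A$) with $\mathcal{N}_A(\vec x,\vec{\mathcal{E}})\subseteq\bigcup_{i\in A}Y_i$. -}

module Defs where

open import Level using (0ℓ)
open import Data.Nat using (ℕ; suc)
open import Data.Fin using (Fin; _≤_)
open import Data.Fin.Subset using (Subset; _∈_; _∉_; _∪_; ⁅_⁆; ∣_∣)
open import Data.Maybe using (Maybe; just; nothing)
open import Data.List using (List)
import Data.List.Membership.Propositional as LMem
open import Data.Product using (Σ; ∃; _×_; _,_)
open import Data.Sum using (_⊎_)
open import Data.Empty using (⊥)
open import Relation.Nullary using (¬_)
open import Relation.Unary using (Pred)
open import Relation.Binary.PropositionalEquality using (_≡_; _≢_)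
open import Function.Bundles using (_↣_)

-- Index set {0,…,n} is Fin (suc n).  A tuple of cardinals is a family of sets.
Card : ℕ → Set₁
Card n = Fin (suc n) → Set

-- weakly increasing: κ i ≤ κ j (as cardinals, i.e. an injection) whenever i ≤ j
WeaklyIncreasing : ∀ {n} → Card n → Set
WeaklyIncreasing {n} κ = (i j : Fin (suc n)) → i ≤ j → κ i ↣ κ j

-- α(K) = K ⊔ {∞}, with ∞ represented by nothing
α : Set → Set
α K = Maybe K

-- Finite subsets of K are given by lists.
_∈L_ : {K : Set} → K → List K → Set
_∈L_ = LMem._∈_

_∉L_ : {K : Set} → K → List K → Set
a ∉L E = ¬ (a ∈L E)

-- Open sets of the one-point compactification of the discrete space K:
-- any set not containing ∞, or a set containing ∞ and cofinitely many points.
IsOpenα : {K : Set} → Pred (α K) 0ℓ → Set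
IsOpenα {K} U = U nothing → Σ (List K) λ E → (a : K) → a ∉L E → U (just a)

X : ∀ {n} → Card n → Set
X {n} κ = (i : Fin (suc n)) → α (κ i)

AllInf : ∀ {n} {κ : Card n} → Pred (X κ) 0ℓ
AllInf {n} x = (i : Fin (suc n)) → x i ≡ nothing

-- Open sets of the product topology (finite product): every point of U
-- has an open box around it contained in U.
IsOpenX : ∀ {n} (κ : Card n) → Pred (X κ) 0ℓ → Set₁
IsOpenX {n} κ U = (x : X κ) → U x →
  Σ ((i : Fin (suc n)) → Pred (α (κ i)) 0ℓ) λ B →
    ((i : Fin (suc n)) → IsOpenα (B i)) ×
    ((i : Fin (suc n)) → B i (x i)) ×
    ((y : X κ) → ((i : Fin (suc n)) → B i (y i)) → U y)

D : ∀ {n} {κ : Card n} → Subset (suc n) → Pred (X κ) 0ℓ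
D {n} A x = (i : Fin (suc n)) → i ∈ A → x i ≢ nothing

F : ∀ {n} {κ : Card n} → Subset (suc n) → Pred (X κ) 0ℓ
F {n} A x = (i : Fin (suc n)) → (i ∈ A → x i ≢ nothing) × (i ∉ A → x i ≡ nothing)

-- 𝒩_A(x, E)  (E j only matters for j ∉ A)
N : ∀ {n} {κ : Card n} → Subset (suc n) → X κ →
    ((j : Fin (suc n)) → List (κ j)) → Pred (X κ) 0ℓ
N {n} A x E y =
  ((i : Fin (suc n)) → i ∈ A → y i ≡ x i) ×
  ((j : Fin (suc n)) → j ∉ A →
     (y j ≡ nothing) ⊎ (Σ _ λ a → (y j ≡ just a) × (a ∉L E j)))

-- V is open in the subspace S: V ∩ S = W ∩ S for some open W of X.
IsOpenIn : ∀ {n} (κ : Card n) → Pred (X κ) 0ℓ → Pred (X κ) 0ℓ → Set₁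
IsOpenIn κ S V = Σ (Pred (X κ) 0ℓ) λ W → IsOpenX κ W ×
  ((x : X κ) → S x → (V x → W x) × (W x → V x))

IsClopenIn : ∀ {n} (κ : Card n) → Pred (X κ) 0ℓ → Pred (X κ) 0ℓ → Set₁
IsClopenIn κ S V = IsOpenIn κ S V × IsOpenIn κ S (λ x → ¬ V x)

-- ⟨Y_i : i ≤ n⟩ is a partition of X(κ)⁻ = X(κ) ∖ {(∞,…,∞)}
IsPartitionX⁻ : ∀ {n} (κ : Card n) → (Fin (suc n) → Pred (X κ) 0ℓ) → Set
IsPartitionX⁻ {n} κ Y =
  ((i : Fin (suc n)) (x : X κ) → Y i x → ¬ AllInf x) ×
  ((x : X κ) → ¬ AllInf x → Σ (Fin (suc n)) λ i → Y i x × ((j : Fin (suc n)) → Y j x → j ≡ i))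

open import Data.Integer using (ℤ; +_; _+_) renaming (_≤_ to _≤ℤ_)

IsKFubini : ∀ {n} (κ : Card n) → ℤ → (Fin (suc n) → Pred (X κ) 0ℓ) → Set₁
IsKFubini {n} κ k Y = IsPartitionX⁻ κ Y ×
  ((A : Subset (suc n)) → k + + 1 ≤ℤ + ∣ A ∣ →
    ((i : Fin (suc n)) → i ∉ A → IsClopenIn κ (D A) (Y i)) ×
    ((x : X κ) → F A x → Σ ((j : Fin (suc n)) → List (κ j)) λ E →
       (y : X κ) → N A x E y → Σ (Fin (suc n)) λ i → (i ∈ A) × Y i y))

{-# OPTIONS --safe #-}
-- Let B be the set of coordinates at which x is finite. Then A ⊆ B, so B is large
-- enough for the Fubini condition, and x ∈ F_B lies in its own neighbourhood
-- 𝒩_B(x, E) for every E. Hence x ∈ Y_j for some j ∈ B, and j = i because the Y's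
-- are disjoint; so x_i ≠ ∞. The converse inclusion is just 𝒟_{A ∪ {i}} ⊆ 𝒟_A.
module Submission where

open import Defs
open import Data.Nat using (ℕ; suc)
open import Data.Integer using (ℤ; +_; -[1+_]; _+_; +≤+) renaming (_≤_ to _≤ℤ_)
open import Data.Integer.Properties using (≤-trans)
open import Data.Bool using (true)
open import Data.Fin using (Fin)
open import Data.Fin.Subset using (Subset; _∈_; _∉_; _∪_; ⁅_⁆; ∣_∣; _⊆_)
open import Data.Fin.Subset.Properties using (p⊆q⇒∣p∣≤∣q∣; p⊆p∪q; x∈p∪q⁻; x∈⁅y⁆⇒x≡y)
open import Data.Maybe using (Maybe; just; nothing; is-just)
open import Data.Vec using (tabulate)
open import Data.Vec.Properties using ([]=⇒lookup; lookup⇒[]=; lookup∘tabulate)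
open import Data.List using (List)
open import Data.Product using (_×_; _,_; proj₂)
open import Data.Sum using (inj₁; inj₂)
open import Function using (_∘_)
open import Relation.Nullary using (contradiction)
open import Relation.Unary using (Pred)
open import Relation.Binary.PropositionalEquality using (_≡_; _≢_; refl; sym; trans; subst)
open import Level using (0ℓ)

private variable
  n : ℕ
  A B : Subset (suc n)
  i j : Fin (suc n)

is-just⇒≢nothing : {K : Set} {m : Maybe K} → is-just m ≡ true → m ≢ nothing
is-just⇒≢nothing {m = just _} _ ()

≢nothing⇒is-just : {K : Set} {m : Maybe K} → m ≢ nothing → is-just m ≡ true
≢nothing⇒is-just {m = just _}  _  = refl
≢nothing⇒is-just {m = nothing} ne = contradiction refl ne

support : {κ : Card n} → X κ → Subset (suc n)
support x = tabulate (is-just ∘ x)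

∈-support⇒≢nothing : {κ : Card n} (x : X κ) → j ∈ support x → x j ≢ nothing
∈-support⇒≢nothing {j = j} x j∈ =
  is-just⇒≢nothing (trans (sym (lookup∘tabulate (is-just ∘ x) j)) ([]=⇒lookup j∈))

≢nothing⇒∈-support : {κ : Card n} (x : X κ) → x j ≢ nothing → j ∈ support x
≢nothing⇒∈-support {j = j} x ne =
  lookup⇒[]= j _ (trans (lookup∘tabulate (is-just ∘ x) j) (≢nothing⇒is-just ne))

∉-support⇒≡nothing : {κ : Card n} {x : X κ} → j ∉ support x → x j ≡ nothing
∉-support⇒≡nothing {j = j} {x = x} j∉ with x j in eq
... | nothing = refl
... | just _  = contradiction (≢nothing⇒∈-support x (subst (_≢ nothing) (sym eq) λ ())) j∉

F-support : {κ : Card n} (x : X κ) → F (support x) x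
F-support x j = ∈-support⇒≢nothing x , ∉-support⇒≡nothing {x = x}

D⇒⊆support : {κ : Card n} {x : X κ} → D A x → A ⊆ support x
D⇒⊆support {x = x} dA {j} j∈A = ≢nothing⇒∈-support x (dA j j∈A)

D-antimono : {κ : Card n} {x : X κ} → A ⊆ B → D B x → D A x
D-antimono A⊆B dB j j∈A = dB j (A⊆B j∈A)

D-∪⁅⁆ : {κ : Card n} {x : X κ} → D A x → x i ≢ nothing → D (A ∪ ⁅ i ⁆) x
D-∪⁅⁆ {A = A} {i = i} {x = x} dA ne j j∈ with x∈p∪q⁻ A ⁅ i ⁆ j∈
... | inj₁ j∈A = dA j j∈A
... | inj₂ j∈i = subst (λ l → x l ≢ nothing) (sym (x∈⁅y⁆⇒x≡y i j∈i)) ne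

F⇒N-self : {κ : Card n} {x : X κ} → F A x → (E : (j : Fin (suc n)) → List (κ j)) → N A x E x
F⇒N-self Fx E = (λ _ _ → refl) , (λ j j∉A → inj₁ (proj₂ (Fx j) j∉A))

IsPartitionX⁻⇒unique : {κ : Card n} {Y : Fin (suc n) → Pred (X κ) 0ℓ} →
                        IsPartitionX⁻ κ Y → {x : X κ} → Y i x → Y j x → i ≡ j
IsPartitionX⁻⇒unique (disjoint , cover) {x} Yi Yj =
  let (_ , _ , unique) = cover x (disjoint _ x Yi) in trans (unique _ Yi) (sym (unique _ Yj))

IsKFubini⇒index∈ : {κ : Card n} {k : ℤ} {Y : Fin (suc n) → Pred (X κ) 0ℓ} →
                   IsKFubini κ k Y → k + + 1 ≤ℤ + ∣ A ∣ →
                   {x : X κ} → F A x → Y i x → i ∈ A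
IsKFubini⇒index∈ {A = A} (partition , fubini) large {x} Fx Yi =
  let (E , covered)    = proj₂ (fubini A large) x Fx
      (j , j∈A , Yj)   = covered x (F⇒N-self Fx E)
  in subst (_∈ A) (IsPartitionX⁻⇒unique partition Yj Yi) j∈A

IsKFubini⇒D⇒≢nothing : {κ : Card n} {k : ℤ} {Y : Fin (suc n) → Pred (X κ) 0ℓ} →
                       IsKFubini κ k Y → k + + 1 ≤ℤ + ∣ A ∣ →
                       {x : X κ} → D A x → Y i x → x i ≢ nothing
IsKFubini⇒D⇒≢nothing {k = k} fubini large {x} dA Yi =
  ∈-support⇒≢nothing x (IsKFubini⇒index∈ {k = k} fubini larger (F-support x) Yi)
  where
  larger : k + + 1 ≤ℤ + ∣ support x ∣
  larger = ≤-trans large (+≤+ (p⊆q⇒∣p∣≤∣q∣ (D⇒⊆support dA)))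

lemma4p4 : (n : ℕ) (κ : Card n) → WeaklyIncreasing κ →
    (k : ℤ) → -[1+ 0 ] ≤ℤ k → k ≤ℤ + n →
    (Y : Fin (suc n) → Pred (X κ) 0ℓ) → IsKFubini κ k Y →
    (A : Subset (suc n)) → k + + 1 ≤ℤ + ∣ A ∣ →
    (i : Fin (suc n)) → i ∉ A →
    (x : X κ) → ((D A x × Y i x) → (D (A ∪ ⁅ i ⁆) x × Y i x)) ×
                ((D (A ∪ ⁅ i ⁆) x × Y i x) → (D A x × Y i x))
lemma4p4 n κ _ k _ _ Y fubini A large i _ x =
  (λ (dA , Yi) → D-∪⁅⁆ dA (IsKFubini⇒D⇒≢nothing {k = k} fubini large dA Yi) , Yi) ,
  (λ (dA∪i , Yi) → D-antimono (p⊆p∪q ⁅ i ⁆) dA∪i , Yi)
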